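{- Let $d\ge1$, $k$ a positive integer, $A_1,\dots,A_k\subseteq\mathbb{Z}^d$ finite sets, and $U=\{0,1,\dots,k-1\}^d$. Then $$|A_1+A_2+\dots+A_k+U|\geq |U|\prod_{i=1}^k|A_i|^{1/k}.$$
   Context: Sums of sets are Minkowski sums; $|\cdot|$ denotes cardinality. -}

module Defs where

open import Data.Nat using (ℕ; zero; suc; _*_)
open import Data.Integer as ℤ using (ℤ; +_)
open import Data.Fin using (Fin; zero; suc)
open import Data.Vec as Vec using (Vec; []; _∷_; zipWith)
open import Data.Vec.Properties using (≡-dec)
open import Data.List as List using (List; []; _∷_; length; deduplicate; concatMap; map; upTo)

Point : ℕ → Set
Point d = Vec ℤ d

_+ᵥ_ : ∀ {d} → Point d → Point d → Point d
_+ᵥ_ = zipWith ℤ._+_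

-- A finite subset of ℤ^d is represented by a list of its elements
-- (duplicates allowed; they do not affect the set).
FinSet : ℕ → Set
FinSet d = List (Point d)

card : ∀ {d} → FinSet d → ℕ
card {d} xs = length (deduplicate (≡-dec ℤ._≟_) xs)

_⊕_ : ∀ {d} → FinSet d → FinSet d → FinSet d
A ⊕ B = concatMap (λ a → map (a +ᵥ_) B) A

cube : (d k : ℕ) → FinSet d
cube zero    k = [] ∷ []
cube (suc d) k = concatMap (λ i → map (λ v → (+ i) ∷ v) (cube d k)) (upTo k)

sumFamily : ∀ {d} k → (Fin k → FinSet d) → FinSet d → FinSet d
sumFamily zero    A U = U
sumFamily (suc k) A U = A zero ⊕ sumFamily k (λ i → A (suc i)) U

prodCard : ∀ {d} k → (Fin k → FinSet d) → ℕ
prodCard zero    A = 1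
prodCard (suc k) A = card (A zero) * prodCard k (λ i → A (suc i))

-- The inequality is the special case, for indicator functions, of a discrete
-- Prékopa–Leindler inequality: if c ∏ αᵢ(xᵢ) ≤ η(x₁ + ⋯ + x_k + u)^k for all xᵢ and all
-- u ∈ {0,…,k−1}^d, then c k^{kd} ∏ ∑ αᵢ ≤ (∑ η)^k. Slicing along the first coordinate reduces
-- this to dimension one. There each αᵢ is cut into level sets {αᵢ ≥ t · max αᵢ}; for one level t
-- the sumset bound |L₁| + ⋯ + |L_k| ≤ |L₁ + ⋯ + L_k + {0,…,k−1}| follows from the extreme
-- elements of the Lᵢ, and summing over t, AM–GM and Minkowski's inequality for k-th roots
-- give the bound. Finally the sets Aᵢ ⊆ ℤ^d are translated into a grid in ℕ^d.

module Submission where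

open import Defs
open import Function using (_∘_)
open import Data.Nat
open import Data.Nat.Properties
open import Data.Nat.Tactic.RingSolver using (solve-∀)
open import Data.Fin using (Fin; zero; suc)
open import Data.Fin.Properties using (all?; ¬∀⟶∃¬)
open import Data.Vec.Functional using (foldr) renaming (_∷_ to _◂_)
open import Data.Vec as Vec using (Vec; []; _∷_; zipWith)
open import Data.Vec.Properties using (∷-injective; ≡-dec)
open import Data.Vec.Relation.Unary.All as AllV using (All; []; _∷_)
open import Data.Integer as ℤ using (-[1+_]; _⊖_; ∣_∣)
import Data.Integer.Properties as ℤ
import Data.Integer.Tactic.RingSolver as ℤ
open import Data.List using (List; []; _∷_; _++_; length; filter; map; upTo; applyUpTo; concatMap; cartesianProductWith; deduplicate)
open import Data.List.Properties using (map-++; map-∘; length-++; length-map; length-upTo)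
open import Data.Nat.ListAction using (sum)
open import Data.Nat.ListAction.Properties using (sum-++)
open import Data.List.Membership.Propositional using (_∈_; lose)
open import Data.List.Membership.Propositional.Properties
  using ( ∈-upTo⁺; ∈-map⁺; ∈-map⁻; ∈-filter⁺; ∈-filter⁻; ∈-concatMap⁺; ∈-cartesianProductWith⁺
        ; ∈-deduplicate⁺; ∈-deduplicate⁻; ∈-∃++; ∈-++⁺ˡ; ∈-++⁺ʳ; ∈-++⁻)
open import Data.List.Relation.Unary.Any using (here; there; any?)
open import Data.List.Relation.Unary.Unique.Propositional using (Unique; []; _∷_)
import Data.List.Relation.Unary.Unique.Propositional.Properties as Unique
open import Data.List.Relation.Unary.Unique.DecPropositional.Properties using (deduplicate-!)
open import Data.List.Extrema ≤-totalOrder using (argmax; f[xs]≤f[argmax])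
import Data.List.Relation.Unary.All as ListAll
open import Data.Product using (∃; _×_; _,_; proj₁; proj₂)
open import Data.Sum using (_⊎_; inj₁; inj₂)
open import Relation.Nullary using (Dec; yes; no; ¬_; contradiction)
open import Relation.Nullary.Decidable using (_×-dec_; _→-dec_)
open import Relation.Unary using (Decidable)
open import Relation.Binary.PropositionalEquality
open import Algebra.Properties.CommutativeSemigroup +-commutativeSemigroup
  using () renaming (interchange to +-interchange)
open import Algebra.Properties.CommutativeSemigroup *-commutativeSemigroup
  using () renaming (interchange to *-interchange; x∙yz≈y∙xz to x*yz≡y*xz)

∑< : ℕ → (ℕ → ℕ) → ℕ
∑< zero    g = 0
∑< (suc n) g = g 0 + ∑< n (g ∘ suc)

syntax ∑< n (λ i → e) = ∑[ i < n ] e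

∑<-cong : ∀ {g h} n → (∀ i → i < n → g i ≡ h i) → ∑< n g ≡ ∑< n h
∑<-cong zero    eq = refl
∑<-cong (suc n) eq = cong₂ _+_ (eq 0 z<s) (∑<-cong n (λ i i<n → eq (suc i) (s<s i<n)))

∑<-mono-≤ : ∀ {g h} n → (∀ i → i < n → g i ≤ h i) → ∑< n g ≤ ∑< n h
∑<-mono-≤ zero    le = z≤n
∑<-mono-≤ (suc n) le = +-mono-≤ (le 0 z<s) (∑<-mono-≤ n (λ i i<n → le (suc i) (s<s i<n)))

∑<-zero : ∀ {g} n → (∀ i → i < n → g i ≡ 0) → ∑< n g ≡ 0
∑<-zero zero    eq = refl
∑<-zero (suc n) eq = cong₂ _+_ (eq 0 z<s) (∑<-zero n (λ i i<n → eq (suc i) (s<s i<n)))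

∑<-distrib-+ : ∀ g h n → ∑[ i < n ] (g i + h i) ≡ ∑< n g + ∑< n h
∑<-distrib-+ g h zero    = refl
∑<-distrib-+ g h (suc n) = trans (cong (g 0 + h 0 +_) (∑<-distrib-+ (g ∘ suc) (h ∘ suc) n)) (+-interchange (g 0) (h 0) _ _)

∑<-distribˡ-* : ∀ c g n → ∑[ i < n ] (c * g i) ≡ c * ∑< n g
∑<-distribˡ-* c g zero    = sym (*-zeroʳ c)
∑<-distribˡ-* c g (suc n) = trans (cong (c * g 0 +_) (∑<-distribˡ-* c (g ∘ suc) n)) (sym (*-distribˡ-+ c (g 0) _))

∑<-split : ∀ g m n → ∑< (m + n) g ≡ ∑< m g + ∑[ i < n ] g (m + i)
∑<-split g zero    n = refl
∑<-split g (suc m) n = trans (cong (g 0 +_) (∑<-split (g ∘ suc) m n)) (sym (+-assoc (g 0) _ _))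

∑<-mono-range : ∀ g {m n} → m ≤ n → ∑< m g ≤ ∑< n g
∑<-mono-range g {m} m≤n with m≤n⇒∃[o]m+o≡n m≤n
... | o , refl = subst (∑< m g ≤_) (sym (∑<-split g m o)) (m≤m+n _ _)

∑<-leading-zeros : ∀ g m n → (∀ i → i < m → g i ≡ 0) → ∑< (m + n) g ≡ ∑[ i < n ] g (m + i)
∑<-leading-zeros g m n zeros = trans (∑<-split g m n) (cong (_+ ∑[ i < n ] g (m + i)) (∑<-zero m zeros))

∑<-trailing-zeros : ∀ g m n → (∀ i → i < n → g (m + i) ≡ 0) → ∑< (m + n) g ≡ ∑< m g
∑<-trailing-zeros g m n zeros = trans (∑<-split g m n) (trans (cong (∑< m g +_) (∑<-zero n zeros)) (+-identityʳ _))

∑<-≤-shift : ∀ g m n → ∑[ i < n ] g (m + i) ≤ ∑< (m + n) g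
∑<-≤-shift g m n = subst (∑[ i < n ] g (m + i) ≤_) (sym (∑<-split g m n)) (m≤n+m _ _)

∑<-comm : ∀ (G : ℕ → ℕ → ℕ) m n → ∑[ i < m ] ∑[ j < n ] G i j ≡ ∑[ j < n ] ∑[ i < m ] G i j
∑<-comm G zero    n = sym (∑<-zero n (λ _ _ → refl))
∑<-comm G (suc m) n = trans (cong (∑< n (G 0) +_) (∑<-comm (G ∘ suc) m n)) (sym (∑<-distrib-+ (G 0) _ n))

∑ᶠ : ∀ {k} → (Fin k → ℕ) → ℕ
∑ᶠ {zero}  f = 0
∑ᶠ {suc k} f = f zero + ∑ᶠ (f ∘ suc)

∏ᶠ : ∀ {k} → (Fin k → ℕ) → ℕ
∏ᶠ {zero}  f = 1
∏ᶠ {suc k} f = f zero * ∏ᶠ (f ∘ suc)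

syntax ∑ᶠ (λ i → e) = ∑ᶠ[ i ] e
syntax ∏ᶠ (λ i → e) = ∏ᶠ[ i ] e

∑ᶠ-cong : ∀ {k} {f g : Fin k → ℕ} → (∀ i → f i ≡ g i) → ∑ᶠ f ≡ ∑ᶠ g
∑ᶠ-cong {zero}  eq = refl
∑ᶠ-cong {suc k} eq = cong₂ _+_ (eq zero) (∑ᶠ-cong (eq ∘ suc))

∏ᶠ-cong : ∀ {k} {f g : Fin k → ℕ} → (∀ i → f i ≡ g i) → ∏ᶠ f ≡ ∏ᶠ g
∏ᶠ-cong {zero}  eq = refl
∏ᶠ-cong {suc k} eq = cong₂ _*_ (eq zero) (∏ᶠ-cong (eq ∘ suc))

∏ᶠ-mono-≤ : ∀ {k} {f g : Fin k → ℕ} → (∀ i → f i ≤ g i) → ∏ᶠ f ≤ ∏ᶠ g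
∏ᶠ-mono-≤ {zero}  le = ≤-refl
∏ᶠ-mono-≤ {suc k} le = *-mono-≤ (le zero) (∏ᶠ-mono-≤ (le ∘ suc))

∏ᶠ-distrib-* : ∀ {k} (f g : Fin k → ℕ) → ∏ᶠ[ i ] (f i * g i) ≡ ∏ᶠ f * ∏ᶠ g
∏ᶠ-distrib-* {zero}  f g = refl
∏ᶠ-distrib-* {suc k} f g = trans (cong (f zero * g zero *_) (∏ᶠ-distrib-* (f ∘ suc) (g ∘ suc))) (*-interchange (f zero) (g zero) _ _)

∑ᶠ-∑<-comm : ∀ {k} (G : Fin k → ℕ → ℕ) n → ∑ᶠ[ i ] ∑< n (G i) ≡ ∑[ j < n ] ∑ᶠ[ i ] G i j
∑ᶠ-∑<-comm {zero}  G n = sym (∑<-zero n (λ _ _ → refl))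
∑ᶠ-∑<-comm {suc k} G n = trans (cong (∑< n (G zero) +_) (∑ᶠ-∑<-comm (G ∘ suc) n)) (sym (∑<-distrib-+ (G zero) _ n))

∏ᶠ-const : ∀ k a → ∏ᶠ {k} (λ _ → a) ≡ a ^ k
∏ᶠ-const zero    a = refl
∏ᶠ-const (suc k) a = cong (a *_) (∏ᶠ-const k a)

∏ᶠ-scale : ∀ {k} a (f : Fin k → ℕ) → ∏ᶠ[ i ] (a * f i) ≡ a ^ k * ∏ᶠ f
∏ᶠ-scale {k} a f = trans (∏ᶠ-distrib-* (λ _ → a) f) (cong (_* ∏ᶠ f) (∏ᶠ-const k a))

∏ᶠ-zero : ∀ {k} (f : Fin k → ℕ) i → f i ≡ 0 → ∏ᶠ f ≡ 0
∏ᶠ-zero f zero    eq = cong (_* ∏ᶠ (f ∘ suc)) eq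
∏ᶠ-zero f (suc i) eq = trans (cong (f zero *_) (∏ᶠ-zero (f ∘ suc) i eq)) (*-zeroʳ (f zero))

∏ᶠ-pos : ∀ {k} (f : Fin k → ℕ) → (∀ i → 0 < f i) → 0 < ∏ᶠ f
∏ᶠ-pos {zero}  f pos = z<s
∏ᶠ-pos {suc k} f pos = *-mono-≤ (pos zero) (∏ᶠ-pos (f ∘ suc) (pos ∘ suc))

∏ᶠ-cofactor : ∀ {k} (f : Fin k → ℕ) i → ∃ λ q → q * f i ≡ ∏ᶠ f
∏ᶠ-cofactor f zero    = ∏ᶠ (f ∘ suc) , *-comm _ (f zero)
∏ᶠ-cofactor f (suc i) with ∏ᶠ-cofactor (f ∘ suc) i
... | q , eq = f zero * q , trans (*-assoc (f zero) q _) (cong (f zero *_) eq)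

∑ᶠ-< : ∀ {k D} (f : Fin (suc k) → ℕ) → (∀ i → f i < D) → ∑ᶠ f < suc k * D
∑ᶠ-< {zero}  f f<D = +-monoˡ-< 0 (f<D zero)
∑ᶠ-< {suc k} f f<D = +-mono-< (f<D zero) (∑ᶠ-< (f ∘ suc) (f<D ∘ suc))

f≤∑ᶠf : ∀ {k} (f : Fin k → ℕ) i → f i ≤ ∑ᶠ f
f≤∑ᶠf f zero    = m≤m+n _ _
f≤∑ᶠf f (suc i) = ≤-trans (f≤∑ᶠf (f ∘ suc) i) (m≤n+m _ _)

^-distrib-* : ∀ a b n → (a * b) ^ n ≡ a ^ n * b ^ n
^-distrib-* a b zero    = refl
^-distrib-* a b (suc n) = trans (cong (a * b *_) (^-distrib-* a b n)) (*-interchange a b _ _)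

bernoulli-lower : ∀ a e p → a ^ p * (a + suc p * e) ≤ (a + e) ^ suc p
bernoulli-lower a e zero    = ≤-reflexive (base a e)
  where
  base : ∀ a e → 1 * (a + 1 * e) ≡ (a + e) * 1
  base = solve-∀
bernoulli-lower a e (suc p) = begin
  a ^ suc p * (a + suc (suc p) * e)                          ≤⟨ m≤m+n _ _ ⟩
  a ^ suc p * (a + suc (suc p) * e) + a ^ p * (suc p * e * e) ≡⟨ step a e (a ^ p) p ⟩
  (a + e) * (a ^ p * (a + suc p * e))                        ≤⟨ *-monoʳ-≤ (a + e) (bernoulli-lower a e p) ⟩
  (a + e) ^ suc (suc p)                                      ∎
  where
  open ≤-Reasoning
  step : ∀ a e x p → a * x * (a + suc (suc p) * e) + x * (suc p * e * e) ≡ (a + e) * (x * (a + suc p * e))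
  step = solve-∀

bernoulli-upper : ∀ g f p → (g + f) ^ suc p ≤ g ^ suc p + suc p * f * (g + f) ^ p
bernoulli-upper g f zero    = ≤-reflexive (base g f)
  where
  base : ∀ g f → (g + f) * 1 ≡ g * 1 + 1 * f * 1
  base = solve-∀
bernoulli-upper g f (suc p) = begin
  (g + f) * (g + f) ^ suc p                                       ≤⟨ *-monoʳ-≤ (g + f) (bernoulli-upper g f p) ⟩
  (g + f) * (g ^ suc p + suc p * f * (g + f) ^ p)                 ≡⟨ expand g f (g ^ suc p) ((g + f) ^ p) p ⟩
  g * g ^ suc p + f * g ^ suc p + suc p * f * (g + f) ^ suc p     ≤⟨ +-monoˡ-≤ _ (+-monoʳ-≤ (g * g ^ suc p) (*-monoʳ-≤ f g^1+p≤[g+f]^1+p)) ⟩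
  g * g ^ suc p + f * (g + f) ^ suc p + suc p * f * (g + f) ^ suc p ≡⟨ collect (g * g ^ suc p) f ((g + f) ^ suc p) p ⟩
  g * g ^ suc p + suc (suc p) * f * (g + f) ^ suc p               ∎
  where
  open ≤-Reasoning
  expand : ∀ g f y x p → (g + f) * (y + suc p * f * x) ≡ g * y + f * y + suc p * f * ((g + f) * x)
  expand = solve-∀
  collect : ∀ a f y p → a + f * y + suc p * f * y ≡ a + suc (suc p) * f * y
  collect = solve-∀
  g^1+p≤[g+f]^1+p : g ^ suc p ≤ (g + f) ^ suc p
  g^1+p≤[g+f]^1+p = ^-monoˡ-≤ (suc p) (m≤m+n g f)

-- Both cases are Bernoulli's inequality around a = (n + 1) x.
weighted-am-gm : ∀ n x y → suc n ^ suc n * (x ^ n * y) ≤ (n * x + y) ^ suc n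
weighted-am-gm n x y with ≤-total x y
... | inj₁ x≤y with m≤n⇒∃[o]m+o≡n x≤y
...   | e , refl = begin
  suc n ^ suc n * (x ^ n * (x + e))  ≡⟨ regroup n (suc n ^ n) (x ^ n) x e ⟩
  suc n ^ n * x ^ n * (a + suc n * e) ≡⟨ cong (_* (a + suc n * e)) (^-distrib-* (suc n) x n) ⟨
  a ^ n * (a + suc n * e)             ≤⟨ bernoulli-lower a e n ⟩
  (a + e) ^ suc n                     ≡⟨ cong (_^ suc n) (rearrange n x e) ⟩
  (n * x + (x + e)) ^ suc n           ∎
  where
  open ≤-Reasoning
  a = suc n * x
  regroup : ∀ n P X x e → suc n * P * (X * (x + e)) ≡ P * X * (suc n * x + suc n * e)
  regroup = solve-∀
  rearrange : ∀ n x e → suc n * x + e ≡ n * x + (x + e)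
  rearrange = solve-∀
weighted-am-gm n x y | inj₂ y≤x with m≤n⇒∃[o]m+o≡n y≤x
...   | f , refl = +-cancelʳ-≤ (suc n * f * a ^ n) _ _ (begin
  suc n ^ suc n * ((y + f) ^ n * y) + suc n * f * a ^ n
    ≡⟨ cong (λ z → suc n ^ suc n * ((y + f) ^ n * y) + suc n * f * z) (^-distrib-* (suc n) (y + f) n) ⟩
  suc n ^ suc n * ((y + f) ^ n * y) + suc n * f * (suc n ^ n * (y + f) ^ n)
    ≡⟨ regroup n (suc n ^ n) ((y + f) ^ n) y f ⟩
  (suc n * y + suc n * f) * (suc n ^ n * (y + f) ^ n)  ≡⟨ cong₂ _*_ (*-distribˡ-+ (suc n) y f) (^-distrib-* (suc n) (y + f) n) ⟨
  a ^ suc n                                             ≡⟨ cong (λ z → z ^ suc n) (split n y f) ⟩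
  (g + f) ^ suc n                                       ≤⟨ bernoulli-upper g f n ⟩
  g ^ suc n + suc n * f * (g + f) ^ n                   ≡⟨ cong (λ z → g ^ suc n + suc n * f * z ^ n) (split n y f) ⟨
  g ^ suc n + suc n * f * a ^ n                         ∎)
  where
  open ≤-Reasoning
  a = suc n * (y + f)
  g = n * (y + f) + y
  regroup : ∀ n P X y f → suc n * P * (X * y) + suc n * f * (P * X) ≡ (suc n * y + suc n * f) * (P * X)
  regroup = solve-∀
  split : ∀ n y f → suc n * (y + f) ≡ n * (y + f) + y + f
  split = solve-∀

am-gm-step : ∀ n s t → suc n ^ suc n * (s ^ n * t) ≤ n ^ n * (s + t) ^ suc n
am-gm-step zero s t = subst₂ _≤_ (base₁ t) (base₂ s t) (m≤n+m t s)
  where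
  base₁ : ∀ t → t ≡ 1 * 1 * (1 * t)
  base₁ = solve-∀
  base₂ : ∀ s t → s + t ≡ 1 * ((s + t) * 1)
  base₂ = solve-∀
am-gm-step n@(suc _) s t = *-cancelˡ-≤ n (begin
  n * (suc n ^ suc n * (s ^ n * t))  ≡⟨ regroup n (suc n ^ suc n) (s ^ n) t ⟩
  suc n ^ suc n * (s ^ n * (n * t))  ≤⟨ weighted-am-gm n s (n * t) ⟩
  (n * s + n * t) ^ suc n            ≡⟨ cong (_^ suc n) (*-distribˡ-+ n s t) ⟨
  (n * (s + t)) ^ suc n              ≡⟨ ^-distrib-* n (s + t) (suc n) ⟩
  n ^ suc n * (s + t) ^ suc n        ≡⟨ *-assoc n (n ^ n) _ ⟩
  n * (n ^ n * (s + t) ^ suc n)      ∎)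
  where
  open ≤-Reasoning
  regroup : ∀ n P S t → n * (P * (S * t)) ≡ P * (S * (n * t))
  regroup = solve-∀

n^n≢0 : ∀ n → NonZero (n ^ n)
n^n≢0 zero    = _
n^n≢0 (suc n) = m^n≢0 (suc n) (suc n)

am-gm : ∀ k (y : Fin k → ℕ) → k ^ k * ∏ᶠ y ≤ ∑ᶠ y ^ k
am-gm zero    y = ≤-refl
am-gm (suc n) y = *-cancelˡ-≤ (n ^ n) {{n^n≢0 n}} (begin
  n ^ n * (suc n ^ suc n * (t * p)) ≡⟨ regroup (n ^ n) (suc n ^ suc n) t p ⟩
  suc n ^ suc n * (n ^ n * p * t)   ≤⟨ *-monoʳ-≤ (suc n ^ suc n) (*-monoˡ-≤ t (am-gm n (y ∘ suc))) ⟩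
  suc n ^ suc n * (s ^ n * t)       ≤⟨ am-gm-step n s t ⟩
  n ^ n * (s + t) ^ suc n           ≡⟨ cong (λ z → n ^ n * z ^ suc n) (+-comm s t) ⟩
  n ^ n * (t + s) ^ suc n           ∎)
  where
  open ≤-Reasoning
  t = y zero
  s = ∑ᶠ (y ∘ suc)
  p = ∏ᶠ (y ∘ suc)
  regroup : ∀ N P t p → N * (P * (t * p)) ≡ P * (N * p * t)
  regroup = solve-∀

infix 3 _·√[_]_≤_

_·√[_]_≤_ : ℕ → ℕ → ℕ → ℕ → Set
r ·√[ k ] P ≤ h = r ^ k * P ≤ h ^ k

-- If b / a ≤ d / c, then a · (b + d) / (a + c) ≥ b, so the bound for a lifts to a + c.
private
  ·√-+-ordered : ∀ k P a b c d → NonZero a → b * c ≤ a * d →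
                 a ·√[ k ] P ≤ b → a + c ·√[ k ] P ≤ b + d
  ·√-+-ordered k P a b c d a≢0 bc≤ad aP≤b =
    *-cancelˡ-≤ (a ^ k) {{m^n≢0 a k {{a≢0}}}} (begin
      a ^ k * ((a + c) ^ k * P) ≡⟨ x*yz≡y*xz (a ^ k) ((a + c) ^ k) P ⟩
      (a + c) ^ k * (a ^ k * P) ≤⟨ *-monoʳ-≤ ((a + c) ^ k) aP≤b ⟩
      (a + c) ^ k * b ^ k       ≡⟨ trans (^-distrib-* b (a + c) k) (*-comm (b ^ k) _) ⟨
      (b * (a + c)) ^ k         ≤⟨ ^-monoˡ-≤ k mediant ⟩
      (a * (b + d)) ^ k         ≡⟨ ^-distrib-* a (b + d) k ⟩
      a ^ k * (b + d) ^ k       ∎)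
    where
    open ≤-Reasoning
    mediant : b * (a + c) ≤ a * (b + d)
    mediant = begin
      b * (a + c)   ≡⟨ *-distribˡ-+ b a c ⟩
      b * a + b * c ≤⟨ +-mono-≤ (≤-reflexive (*-comm b a)) bc≤ad ⟩
      a * b + a * d ≡⟨ *-distribˡ-+ a b d ⟨
      a * (b + d)   ∎

·√-+ : ∀ k P a b c d → a ·√[ k ] P ≤ b → c ·√[ k ] P ≤ d → a + c ·√[ k ] P ≤ b + d
·√-+ k P zero b c d _ cP≤d = ≤-trans cP≤d (^-monoˡ-≤ k (m≤n+m d b))
·√-+ k P a@(suc _) b zero d aP≤b _ =
  ≤-trans (subst (λ z → z ·√[ k ] P ≤ b) (sym (+-identityʳ a)) aP≤b) (^-monoˡ-≤ k (m≤m+n b d))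
·√-+ k P a@(suc _) b c@(suc _) d aP≤b cP≤d with ≤-total (b * c) (a * d)
... | inj₁ bc≤ad = ·√-+-ordered k P a b c d _ bc≤ad aP≤b
... | inj₂ ad≤bc = subst₂ (λ x y → x ·√[ k ] P ≤ y) (+-comm c a) (+-comm d b)
                     (·√-+-ordered k P c d a b _ (subst₂ _≤_ (*-comm a d) (*-comm b c) ad≤bc) cP≤d)

·√-∑< : ∀ k P (r h : ℕ → ℕ) n → (∀ i → i < n → r i ·√[ suc k ] P ≤ h i) → ∑< n r ·√[ suc k ] P ≤ ∑< n h
·√-∑< k P r h zero    bound = z≤n
·√-∑< k P r h (suc n) bound = ·√-+ (suc k) P (r 0) (h 0) _ _ (bound 0 z<s)
  (·√-∑< k P (r ∘ suc) (h ∘ suc) n (λ i i<n → bound (suc i) (s<s i<n)))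

χ : ∀ {A : Set} → Dec A → ℕ
χ (yes _) = 1
χ (no _)  = 0

χ-mono : ∀ {A B : Set} (a? : Dec A) (b? : Dec B) → (A → B) → χ a? ≤ χ b?
χ-mono (yes a) (yes _) _   = ≤-refl
χ-mono (yes a) (no ¬b) a→b = contradiction (a→b a) ¬b
χ-mono (no _)  _       _   = z≤n

χ-cong : ∀ {A B : Set} (a? : Dec A) (b? : Dec B) → (A → B) → (B → A) → χ a? ≡ χ b?
χ-cong a? b? a→b b→a = ≤-antisym (χ-mono a? b? a→b) (χ-mono b? a? b→a)

χ-yes : ∀ {A : Set} (a? : Dec A) → A → χ a? ≡ 1
χ-yes (yes _) _ = refl
χ-yes (no ¬a) a = contradiction a ¬a

χ≤1 : ∀ {A : Set} (a? : Dec A) → χ a? ≤ 1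
χ≤1 (yes _) = ≤-refl
χ≤1 (no _)  = z≤n

χ-¬ : ∀ {A : Set} (a? : Dec A) → ¬ A → χ a? ≡ 0
χ-¬ (yes a) ¬a = contradiction a ¬a
χ-¬ (no _)  _  = refl

count : ∀ {P : ℕ → Set} → Decidable P → ℕ → ℕ
count P? n = ∑[ i < n ] χ (P? i)

count-< : ∀ {t n} → t ≤ n → count (_<? t) n ≡ t
count-< {zero}  {n}     _         = ∑<-zero n (λ i _ → χ-¬ (i <? 0) λ ())
count-< {suc t} {suc n} (s≤s t≤n) =
  cong suc (trans (∑<-cong n (λ i _ → χ-cong (suc i <? suc t) (i <? t) s<s⁻¹ s<s)) (count-< t≤n))

count-downClosed : ∀ {P : ℕ → Set} (P? : Decidable P) n → (∀ {j} → P (suc j) → P j) →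
                   count P? n ≡ 0 ⊎ ∃ λ r → count P? n ≡ suc r × P r
count-downClosed P? zero    _    = inj₁ refl
count-downClosed {P} P? (suc n) down with P? 0
... | no ¬p0 = inj₁ (∑<-zero n (λ j _ → χ-¬ (P? (suc j)) (none (suc j))))
  where
  none : ∀ j → ¬ P j
  none zero    = ¬p0
  none (suc j) = none j ∘ down
... | yes p0 with count-downClosed (P? ∘ suc) n down
...   | inj₁ eq           = inj₂ (0 , cong suc eq , p0)
...   | inj₂ (r , eq , pr) = inj₂ (suc r , cong suc eq , pr)

count-·√-≤ : ∀ K a h n → count (λ j → suc j ^ suc K * a ≤? h ^ suc K) n ·√[ suc K ] a ≤ h
count-·√-≤ K a h n with count-downClosed (λ j → suc j ^ suc K * a ≤? h ^ suc K) n
                          (≤-trans (*-monoˡ-≤ a (^-monoˡ-≤ (suc K) (n≤1+n _))))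
... | inj₁ eq           rewrite eq = z≤n
... | inj₂ (r , eq , pr) rewrite eq = pr

least : ∀ {P : ℕ → Set} → Decidable P → ∀ {x} → P x → ∃ λ m → P m × (∀ {i} → i < m → ¬ P i)
least P? {zero}  p0 = 0 , p0 , λ ()
least P? {suc x} px with P? 0
... | yes p0 = 0 , p0 , λ ()
... | no ¬p0 with least (P? ∘ suc) px
...   | m , pm , below = suc m , pm , λ { {zero} _ → ¬p0 ; {suc i} i<m → below (s<s⁻¹ i<m) }

greatest : ∀ {P : ℕ → Set} → Decidable P → ∀ n {x} → x < n → P x →
           ∃ λ M → M < n × P M × (∀ {j} → M < j → j < n → ¬ P j)
greatest {P} P? (suc n) {x} x<1+n px with P? n
... | yes pn = n , ≤-refl , pn , λ n<j j<1+n → contradiction (<-≤-trans n<j (s≤s⁻¹ j<1+n)) (n≮n n)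
... | no ¬pn with m<1+n⇒m<n∨m≡n x<1+n
...   | inj₂ refl = contradiction px ¬pn
...   | inj₁ x<n with greatest P? n x<n px
...     | M , M<n , pM , above = M , m<n⇒m<1+n M<n , pM , above′
  where
  above′ : ∀ {j} → M < j → j < suc n → ¬ P j
  above′ {j} M<j j<1+n with m<1+n⇒m<n∨m≡n j<1+n
  ... | inj₁ j<n  = above M<j j<n
  ... | inj₂ refl = ¬pn

-- With m = min X and M = max Y, the sets m + Y ⊆ [m, m + M] and X + M + 1 ⊆ [m + M + 1, ∞)
-- are disjoint subsets of Z.
count-sumset : ∀ {X Y Z : ℕ → Set} (X? : Decidable X) (Y? : Decidable Y) (Z? : Decidable Z) D E →
               (∀ {x} → X x → x < D) → ∃ X → (∃ λ y → y < E × Y y) →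
               (∀ {x y} → X x → y < E → Y y → Z (x + y) × Z (suc (x + y))) →
               count X? D + count Y? E ≤ count Z? (D + E)
count-sumset {Z = Z} X? Y? Z? D E X<D (_ , Xx) (_ , y<E , Yy) X+Y⊆Z
  with least X? Xx | greatest Y? E y<E Yy
... | m , Xm , ¬X<m | M , M<E , YM , ¬Y>M
  with m≤n⇒∃[o]m+o≡n (<⇒≤ (X<D Xm)) | m≤n⇒∃[o]m+o≡n M<E
... | r , refl | q , refl = begin
  count X? (m + r) + count Y? (suc M + q)
    ≡⟨ cong₂ _+_ (∑<-leading-zeros (χ ∘ X?) m r (λ i i<m → χ-¬ (X? i) (¬X<m i<m)))
                 (∑<-trailing-zeros (χ ∘ Y?) (suc M) q
                   (λ i i<q → χ-¬ (Y? (suc M + i)) (¬Y>M (s≤s (m≤m+n M i)) (+-monoʳ-< (suc M) i<q)))) ⟩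
  ∑[ i < r ] χ (X? (m + i)) + count Y? (suc M)
    ≡⟨ +-comm (∑[ i < r ] χ (X? (m + i))) (count Y? (suc M)) ⟩
  count Y? (suc M) + ∑[ i < r ] χ (X? (m + i))
    ≤⟨ +-mono-≤ (∑<-mono-≤ (suc M) (λ i i≤M → χ-mono (Y? i) (Z? (m + i))
                                                (proj₁ ∘ X+Y⊆Z Xm (≤-trans i≤M (m≤m+n _ q)))))
                (∑<-mono-≤ r (λ i _ → χ-mono (X? (m + i)) (Z? (m + (suc M + i)))
                                       (λ Xi → subst Z (reindex m i M) (proj₂ (X+Y⊆Z Xi M<E YM))))) ⟩
  ∑[ i < suc M ] χ (Z? (m + i)) + ∑[ i < r ] χ (Z? (m + (suc M + i)))
    ≡⟨ ∑<-split (λ i → χ (Z? (m + i))) (suc M) r ⟨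
  ∑[ i < suc M + r ] χ (Z? (m + i))
    ≤⟨ ∑<-≤-shift (χ ∘ Z?) m (suc M + r) ⟩
  count Z? (m + (suc M + r))
    ≤⟨ ∑<-mono-range (χ ∘ Z?) (≤-reflexive (rearrange m M r)) ⟩
  count Z? (m + r + suc M)
    ≤⟨ ∑<-mono-range (χ ∘ Z?) (+-monoʳ-≤ (m + r) (m≤m+n (suc M) q)) ⟩
  count Z? (m + r + (suc M + q))
    ∎
  where
  open ≤-Reasoning
  reindex : ∀ m i M → suc (m + i + M) ≡ m + (suc M + i)
  reindex = solve-∀
  rearrange : ∀ m M r → m + (suc M + r) ≡ m + r + suc M
  rearrange = solve-∀

count-∑ᶠ-sumset : ∀ k D {L : Fin (suc k) → ℕ → Set} (L? : ∀ i → Decidable (L i)) {Z : ℕ → Set} (Z? : Decidable Z) →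
                  (∀ i {x} → L i x → x < D) → (∀ i → ∃ (L i)) →
                  (∀ (n : Fin (suc k) → ℕ) u → (∀ i → L i (n i)) → u < suc k → Z (∑ᶠ n + u)) →
                  ∑ᶠ[ i ] count (L? i) D ≤ count Z? (suc k * D)
count-∑ᶠ-sumset zero D {L} L? {Z} Z? _ _ ⊆Z = begin
  count (L? zero) D + 0 ≡⟨ +-identityʳ _ ⟩
  count (L? zero) D     ≤⟨ ∑<-mono-≤ D (λ x _ → χ-mono (L? zero x) (Z? x) (single x)) ⟩
  count Z? D            ≡⟨ cong (count Z?) (+-identityʳ D) ⟨
  count Z? (1 * D)      ∎
  where
  open ≤-Reasoning
  single : ∀ x → L zero x → Z x
  single x Lx = subst Z (trans (+-identityʳ _) (+-identityʳ x)) (⊆Z (λ _ → x) 0 (λ { zero → Lx }) z<s)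
-- The sum of the other sets lands in Z′ = {w | x + w, x + w + 1 ∈ Z for all x ∈ L 0}.
count-∑ᶠ-sumset (suc k) D {L} L? {Z} Z? L<D ∃L ⊆Z =
  ≤-trans (+-monoʳ-≤ (count (L? zero) D) (count-∑ᶠ-sumset k D (L? ∘ suc) Z′? (L<D ∘ suc) (∃L ∘ suc) ⊆Z′))
          (count-sumset (L? zero) Z′? Z? D (suc k * D) (L<D zero) (∃L zero) (y₀ , y₀<E , Z′y₀)
                        (λ Lx _ Z′y → Z′y (L<D zero Lx) Lx))
  where
  Z′ : ℕ → Set
  Z′ w = ∀ {x} → x < D → L zero x → Z (x + w) × Z (suc (x + w))
  Z′? : Decidable Z′
  Z′? w = allUpTo? (λ x → L? zero x →-dec (Z? (x + w) ×-dec Z? (suc (x + w)))) D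
  ⊆Z′ : ∀ (n : Fin (suc k) → ℕ) u → (∀ i → L (suc i) (n i)) → u < suc k → Z′ (∑ᶠ n + u)
  ⊆Z′ n u Ln u<1+k {x} _ Lx =
    subst Z (+-assoc x _ u) (⊆Z (x ◂ n) u L∷ (m<n⇒m<1+n u<1+k)) ,
    subst Z (trans (+-suc (x + ∑ᶠ n) u) (cong suc (+-assoc x _ u))) (⊆Z (x ◂ n) (suc u) L∷ (s<s u<1+k))
    where
    L∷ : ∀ i → L i ((x ◂ n) i)
    L∷ zero    = Lx
    L∷ (suc i) = Ln i
  n₀ : Fin (suc k) → ℕ
  n₀ i = proj₁ (∃L (suc i))
  y₀ = ∑ᶠ n₀ + 0
  y₀<E : y₀ < suc k * D
  y₀<E = subst (_< suc k * D) (sym (+-identityʳ _)) (∑ᶠ-< n₀ (λ i → L<D (suc i) (proj₂ (∃L (suc i)))))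
  Z′y₀ : Z′ y₀
  Z′y₀ = ⊆Z′ n₀ 0 (proj₂ ∘ ∃L ∘ suc) z<s

-- A discrete Prékopa–Leindler inequality on ℕ

count-levels : ∀ {M} .{{_ : NonZero M}} {Q N f} → Q * M ≡ N → f ≤ M →
               count (λ j → suc j * M ≤? N * f) N ≡ Q * f
count-levels {M} {Q} {N} {f} QM≡N f≤M = begin-equality
  count (λ j → suc j * M ≤? N * f) N ≡⟨ ∑<-cong N (λ j _ → χ-cong (suc j * M ≤? N * f) (j <? Q * f) cancel uncancel) ⟩
  count (_<? Q * f) N               ≡⟨ count-< (subst (Q * f ≤_) QM≡N (*-monoʳ-≤ Q f≤M)) ⟩
  Q * f                             ∎
  where
  open ≤-Reasoning
  regroup : ∀ Q M f → Q * M * f ≡ Q * f * M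
  regroup = solve-∀
  N*f≡Q*f*M : N * f ≡ Q * f * M
  N*f≡Q*f*M = trans (cong (_* f) (sym QM≡N)) (regroup Q M f)
  cancel : ∀ {j} → suc j * M ≤ N * f → j < Q * f
  cancel {j} le = *-cancelʳ-≤ (suc j) (Q * f) M (subst (suc j * M ≤_) N*f≡Q*f*M le)
  uncancel : ∀ {j} → j < Q * f → suc j * M ≤ N * f
  uncancel {j} j<Qf = subst (suc j * M ≤_) (sym N*f≡Q*f*M) (*-monoˡ-≤ M j<Qf)

layer-cake : ∀ {M} .{{_ : NonZero M}} {Q N} D (f : ℕ → ℕ) → Q * M ≡ N → (∀ {x} → x < D → f x ≤ M) →
             ∑[ j < N ] count (λ x → suc j * M ≤? N * f x) D ≡ Q * ∑< D f
layer-cake {M} {Q} {N} D f QM≡N f≤M =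
  trans (∑<-comm (λ j x → χ (suc j * M ≤? N * f x)) N D)
        (trans (∑<-cong D (λ x x<D → count-levels {Q = Q} QM≡N (f≤M x<D))) (∑<-distribˡ-* Q f D))

module Prékopa–Leindler-ℕ {k D : ℕ} {F : Fin (suc k) → ℕ → ℕ} {H : ℕ → ℕ} {c : ℕ}
  (F-supp : ∀ i {x} → D ≤ x → F i x ≡ 0)
  (F≤H : ∀ (n : Fin (suc k) → ℕ) u → u < suc k → c * ∏ᶠ[ i ] F i (n i) ≤ H (∑ᶠ n + u) ^ suc k)
  where

  private
    K = suc k

    S : Fin K → ℕ
    S i = ∑< D (F i)

    top : Fin K → ℕ
    top i = argmax (F i) 0 (upTo D)

    M : Fin K → ℕ
    M i = F i (top i)

    F≤M : ∀ i {x} → x < D → F i x ≤ M i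
    F≤M i x<D = ListAll.lookup (f[xs]≤f[argmax] 0 (upTo D)) (∈-upTo⁺ x<D)

    Goal = c * K ^ K * ∏ᶠ S ≤ ∑< (K * D) H ^ K

    degenerate : ∀ i → M i ≡ 0 → Goal
    degenerate i Mi≡0 = subst (_≤ ∑< (K * D) H ^ K) (sym (trans (cong (c * K ^ K *_) (∏ᶠ-zero S i Si≡0)) (*-zeroʳ (c * K ^ K)))) z≤n
      where
      Si≡0 : S i ≡ 0
      Si≡0 = ∑<-zero D (λ x x<D → n≤0⇒n≡0 (subst (F i x ≤_) Mi≡0 (F≤M i x<D)))

    -- Level j of F i is {x | F i x / M i ≥ (j + 1) / N}, where M i = max (F i) and N = ∏ M;
    -- scaling by N keeps every threshold integral, and x lies in exactly Q i · F i x levels j < N,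
    -- where Q i = N / M i.
    module _ (M>0 : ∀ i → 0 < M i) where

      N = ∏ᶠ M

      instance
        N≢0 : NonZero N
        N≢0 = >-nonZero (∏ᶠ-pos M M>0)

      Q : Fin K → ℕ
      Q i = proj₁ (∏ᶠ-cofactor M i)

      QM≡N : ∀ i → Q i * M i ≡ N
      QM≡N i = proj₂ (∏ᶠ-cofactor M i)

      Level : ℕ → Fin K → ℕ → Set
      Level j i x = suc j * M i ≤ N * F i x

      level? : ∀ j i → Decidable (Level j i)
      level? j i x = suc j * M i ≤? N * F i x

      Λ : ℕ → ℕ → Set
      Λ j z = suc j ·√[ K ] c * N ≤ N * H z

      Λ? : ∀ j → Decidable (Λ j)
      Λ? j z = suc j ^ K * (c * N) ≤? (N * H z) ^ K

      Level<D : ∀ j i {x} → Level j i x → x < D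
      Level<D j i {x} lvl with D ≤? x
      ... | no D≰x  = ≰⇒> D≰x
      ... | yes D≤x = contradiction lvl (<⇒≱ (begin-strict
        N * F i x   ≡⟨ cong (N *_) (F-supp i D≤x) ⟩
        N * 0       ≡⟨ *-zeroʳ N ⟩
        0           <⟨ M>0 i ⟩
        M i         ≤⟨ m≤n*m (M i) (suc j) ⟩
        suc j * M i ∎))
        where open ≤-Reasoning

      Level-nonempty : ∀ j → j < N → ∀ i → ∃ (Level j i)
      Level-nonempty j j<N i = top i , *-monoˡ-≤ (M i) {suc j} {N} j<N

      Level-sum⊆Λ : ∀ j (n : Fin K → ℕ) u → (∀ i → Level j i (n i)) → u < K → Λ j (∑ᶠ n + u)
      Level-sum⊆Λ j n u lvl u<K = begin
        suc j ^ K * (c * N)                  ≡⟨ x*yz≡y*xz (suc j ^ K) c N ⟩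
        c * (suc j ^ K * N)                  ≡⟨ cong (c *_) (∏ᶠ-scale (suc j) M) ⟨
        c * ∏ᶠ[ i ] (suc j * M i)            ≤⟨ *-monoʳ-≤ c (∏ᶠ-mono-≤ lvl) ⟩
        c * ∏ᶠ[ i ] (N * F i (n i))          ≡⟨ cong (c *_) (∏ᶠ-scale N (λ i → F i (n i))) ⟩
        c * (N ^ K * ∏ᶠ[ i ] F i (n i))      ≡⟨ x*yz≡y*xz c (N ^ K) _ ⟩
        N ^ K * (c * ∏ᶠ[ i ] F i (n i))      ≤⟨ *-monoʳ-≤ (N ^ K) (F≤H n u u<K) ⟩
        N ^ K * H (∑ᶠ n + u) ^ K             ≡⟨ ^-distrib-* N _ K ⟨
        (N * H (∑ᶠ n + u)) ^ K               ∎
        where open ≤-Reasoning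

      levels-sumset : ∀ j → j < N → ∑ᶠ[ i ] count (level? j i) D ≤ count (Λ? j) (K * D)
      levels-sumset j j<N = count-∑ᶠ-sumset k D (level? j) (Λ? j) (Level<D j) (Level-nonempty j j<N) (Level-sum⊆Λ j)

      R : ℕ → ℕ
      R z = count (λ j → Λ? j z) N

      ∑QS≤∑R : ∑ᶠ[ i ] (Q i * S i) ≤ ∑< (K * D) R
      ∑QS≤∑R = begin
        ∑ᶠ[ i ] (Q i * S i)
          ≡⟨ ∑ᶠ-cong (λ i → layer-cake {{>-nonZero (M>0 i)}} {Q i} D (F i) (QM≡N i) (F≤M i)) ⟨
        ∑ᶠ[ i ] ∑[ j < N ] count (level? j i) D ≡⟨ ∑ᶠ-∑<-comm (λ i j → count (level? j i) D) N ⟩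
        ∑[ j < N ] ∑ᶠ[ i ] count (level? j i) D ≤⟨ ∑<-mono-≤ N levels-sumset ⟩
        ∑[ j < N ] count (Λ? j) (K * D)         ≡⟨ ∑<-comm (λ j z → χ (Λ? j z)) N (K * D) ⟩
        ∑< (K * D) R                            ∎
        where open ≤-Reasoning

      ∏Q*N≡N^K : ∏ᶠ Q * N ≡ N ^ K
      ∏Q*N≡N^K = trans (sym (∏ᶠ-distrib-* Q M)) (trans (∏ᶠ-cong QM≡N) (∏ᶠ-const K N))

      bound : Goal
      bound = *-cancelˡ-≤ (N ^ K) {{m^n≢0 N K}} (begin
        N ^ K * (c * K ^ K * ∏ᶠ S)             ≡⟨ cong (_* (c * K ^ K * ∏ᶠ S)) ∏Q*N≡N^K ⟨
        ∏ᶠ Q * N * (c * K ^ K * ∏ᶠ S)          ≡⟨ regroup (∏ᶠ Q) N c (K ^ K) (∏ᶠ S) ⟩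
        K ^ K * (∏ᶠ Q * ∏ᶠ S) * (c * N)        ≡⟨ cong (λ p → K ^ K * p * (c * N)) (∏ᶠ-distrib-* Q S) ⟨
        K ^ K * ∏ᶠ[ i ] (Q i * S i) * (c * N)  ≤⟨ *-monoˡ-≤ (c * N) (am-gm K (λ i → Q i * S i)) ⟩
        ∑ᶠ[ i ] (Q i * S i) ^ K * (c * N)      ≤⟨ *-monoˡ-≤ (c * N) (^-monoˡ-≤ K ∑QS≤∑R) ⟩
        ∑< (K * D) R ^ K * (c * N)
          ≤⟨ ·√-∑< k (c * N) R (λ z → N * H z) (K * D) (λ z _ → count-·√-≤ k (c * N) (N * H z) N) ⟩
        ∑[ z < K * D ] (N * H z) ^ K           ≡⟨ cong (_^ K) (∑<-distribˡ-* N H (K * D)) ⟩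
        (N * ∑< (K * D) H) ^ K                 ≡⟨ ^-distrib-* N (∑< (K * D) H) K ⟩
        N ^ K * ∑< (K * D) H ^ K               ∎)
        where
        open ≤-Reasoning
        regroup : ∀ q N c P s → q * N * (c * P * s) ≡ P * (q * s) * (c * N)
        regroup = solve-∀

  theorem : c * suc k ^ suc k * ∏ᶠ[ i ] ∑< D (F i) ≤ ∑< (suc k * D) H ^ suc k
  theorem with all? (λ i → 0 <? M i)
  ... | yes M>0 = bound M>0
  ... | no ¬M>0 with ¬∀⟶∃¬ K _ (λ i → 0 <? M i) ¬M>0
  ...   | i , 0≮Mi = degenerate i (n≤0⇒n≡0 (≮⇒≥ 0≮Mi))

-- The d-dimensional inequality on the grid {0, …, D − 1}^d

∑□ : ∀ d → ℕ → (Vec ℕ d → ℕ) → ℕ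
∑□ zero    D g = g []
∑□ (suc d) D g = ∑[ n < D ] ∑□ d D (λ q → g (n ∷ q))

∑□-zero : ∀ d D {g} → (∀ q → g q ≡ 0) → ∑□ d D g ≡ 0
∑□-zero zero    D zeros = zeros []
∑□-zero (suc d) D zeros = ∑<-zero D (λ n _ → ∑□-zero d D (λ q → zeros (n ∷ q)))

_+ⁿ_ : ∀ {d} → Vec ℕ d → Vec ℕ d → Vec ℕ d
_+ⁿ_ = zipWith _+_

foldr-+ⁿ-∷ : ∀ {k d} (n : Fin k → ℕ) (x : Fin k → Vec ℕ d) u us →
             foldr _+ⁿ_ (u ∷ us) (λ i → n i ∷ x i) ≡ (∑ᶠ n + u) ∷ foldr _+ⁿ_ us x
foldr-+ⁿ-∷ {zero}  n x u us = refl
foldr-+ⁿ-∷ {suc k} n x u us rewrite foldr-+ⁿ-∷ (n ∘ suc) (x ∘ suc) u us =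
  cong (_∷ foldr _+ⁿ_ us x) (sym (+-assoc (n zero) (∑ᶠ (n ∘ suc)) u))

prékopa–leindler : ∀ d k D c (α : Fin (suc k) → Vec ℕ d → ℕ) (η : Vec ℕ d → ℕ) →
                   (∀ i {p} → ¬ All (_< D) p → α i p ≡ 0) →
                   (∀ (x : Fin (suc k) → Vec ℕ d) u → All (_< suc k) u → c * ∏ᶠ[ i ] α i (x i) ≤ η (foldr _+ⁿ_ u x) ^ suc k) →
                   c * (suc k ^ suc k) ^ d * ∏ᶠ[ i ] ∑□ d D (α i) ≤ ∑□ d (suc k * D) η ^ suc k
prékopa–leindler zero k D c α η _ α≤η =
  subst₂ (λ a p → a * ∏ᶠ[ i ] α i [] ≤ η p ^ suc k) (sym (*-identityʳ c)) (empty _) (α≤η (λ _ → []) [] [])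
  where
  empty : (v : Vec ℕ 0) → v ≡ []
  empty [] = refl
prékopa–leindler (suc d) k D c α η α-supp α≤η =
  subst (_≤ ∑□ (suc d) (K * D) η ^ K) (regroup c (K ^ K) ((K ^ K) ^ d) (∏ᶠ[ i ] ∑□ (suc d) D (α i)))
        (Prékopa–Leindler-ℕ.theorem {c = c * (K ^ K) ^ d} F-supp F≤H)
  where
  K = suc k
  F : Fin K → ℕ → ℕ
  F i n = ∑□ d D (λ q → α i (n ∷ q))
  H : ℕ → ℕ
  H m = ∑□ d (K * D) (λ q → η (m ∷ q))
  F-supp : ∀ i {n} → D ≤ n → F i n ≡ 0
  F-supp i D≤n = ∑□-zero d D (λ q → α-supp i (λ { (n<D ∷ _) → <⇒≱ n<D D≤n }))
  F≤H : ∀ (n : Fin K → ℕ) u → u < K → c * (K ^ K) ^ d * ∏ᶠ[ i ] F i (n i) ≤ H (∑ᶠ n + u) ^ K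
  F≤H n u u<K = prékopa–leindler d k D c (λ i q → α i (n i ∷ q)) (λ q → η ((∑ᶠ n + u) ∷ q))
    (λ i ¬q<D → α-supp i (λ { (_ ∷ q<D) → ¬q<D q<D }))
    (λ x us us<K → subst (λ p → c * ∏ᶠ[ i ] α i (n i ∷ x i) ≤ η p ^ K) (foldr-+ⁿ-∷ n x u us)
                         (α≤η (λ i → n i ∷ x i) (u ∷ us) (u<K ∷ us<K)))
  regroup : ∀ c P Q X → c * Q * P * X ≡ c * (P * Q) * X
  regroup = solve-∀

-- Shifting the grid into ℤ^d

shift : ∀ {d} → ℕ → Vec ℕ d → Point d
shift B = Vec.map (_⊖ B)

⊖-+-⊖ : ∀ m a n b → (m ⊖ a) ℤ.+ (n ⊖ b) ≡ (m + n) ⊖ (a + b)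
⊖-+-⊖ m a n b = begin
  (m ⊖ a) ℤ.+ (n ⊖ b)                                    ≡⟨ cong₂ ℤ._+_ (ℤ.[+m]-[+n]≡m⊖n m a) (ℤ.[+m]-[+n]≡m⊖n n b) ⟨
  (ℤ.+ m ℤ.- ℤ.+ a) ℤ.+ (ℤ.+ n ℤ.- ℤ.+ b)                ≡⟨ regroup (ℤ.+ m) (ℤ.+ a) (ℤ.+ n) (ℤ.+ b) ⟩
  (ℤ.+ m ℤ.+ ℤ.+ n) ℤ.- (ℤ.+ a ℤ.+ ℤ.+ b)                ≡⟨ cong₂ ℤ._-_ (ℤ.pos-+ m n) (ℤ.pos-+ a b) ⟨
  ℤ.+ (m + n) ℤ.- ℤ.+ (a + b)                            ≡⟨ ℤ.[+m]-[+n]≡m⊖n (m + n) (a + b) ⟩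
  (m + n) ⊖ (a + b)                                      ∎
  where
  open ≡-Reasoning
  regroup : ∀ m a n b → (m ℤ.- a) ℤ.+ (n ℤ.- b) ≡ (m ℤ.+ n) ℤ.- (a ℤ.+ b)
  regroup = ℤ.solve-∀

⊖-cancelʳ : ∀ B {m n} → m ⊖ B ≡ n ⊖ B → m ≡ n
⊖-cancelʳ B {m} {n} eq = ℤ.+-injective (trans (sym (restore m)) (trans (cong (ℤ._+ ℤ.+ B) eq) (restore n)))
  where
  restore : ∀ m → (m ⊖ B) ℤ.+ ℤ.+ B ≡ ℤ.+ m
  restore m = trans (ℤ.distribˡ-⊖-+-pos B m B) (trans (ℤ.⊖-≥ (m≤n+m B m)) (cong ℤ.+_ (m+n∸n≡m m B)))

⊖-bounded : ∀ B m → ∣ m ⊖ B ∣ ≤ B → m < suc (B + B)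
⊖-bounded B m ∣m⊖B∣≤B with m ≤? B
... | yes m≤B = s≤s (≤-trans m≤B (m≤m+n B B))
... | no m≰B  = s≤s (begin
  m            ≡⟨ m+[n∸m]≡n B≤m ⟨
  B + (m ∸ B)  ≤⟨ +-monoʳ-≤ B (subst (_≤ B) (cong ∣_∣ (ℤ.⊖-≥ B≤m)) ∣m⊖B∣≤B) ⟩
  B + B        ∎)
  where
  open ≤-Reasoning
  B≤m = <⇒≤ (≰⇒> m≰B)

⊖-onto : ∀ B x → ∣ x ∣ ≤ B → ∃ λ m → m < suc (B + B) × m ⊖ B ≡ x
⊖-onto B (ℤ.+ m)  m≤B  = B + m , s≤s (+-monoʳ-≤ B m≤B) , trans (ℤ.⊖-≥ (m≤m+n B m)) (cong ℤ.+_ (m+n∸m≡n B m))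
⊖-onto B -[1+ m ] 1+m≤B = B ∸ suc m , s≤s (≤-trans (m∸n≤m B (suc m)) (m≤m+n B B)) ,
                          trans (ℤ.⊖-≤ (m∸n≤m B (suc m))) (cong (ℤ.-_ ∘ ℤ.+_) (m∸[m∸n]≡n 1+m≤B))

Bounded : ∀ {d} → ℕ → Point d → Set
Bounded B = All (λ x → ∣ x ∣ ≤ B)

shift-injective : ∀ {d} B {p q : Vec ℕ d} → shift B p ≡ shift B q → p ≡ q
shift-injective B {[]}    {[]}    _  = refl
shift-injective B {_ ∷ _} {_ ∷ _} eq with ∷-injective eq
... | head≡ , tail≡ = cong₂ _∷_ (⊖-cancelʳ B head≡) (shift-injective B tail≡)

shift-bounded : ∀ {d} B (p : Vec ℕ d) → Bounded B (shift B p) → All (_< suc (B + B)) p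
shift-bounded B []      []          = []
shift-bounded B (m ∷ p) (m≤ ∷ p≤) = ⊖-bounded B m m≤ ∷ shift-bounded B p p≤

shift-onto : ∀ {d} B (a : Point d) → Bounded B a → ∃ λ p → All (_< suc (B + B)) p × shift B p ≡ a
shift-onto B []      []          = [] , [] , refl
shift-onto B (x ∷ a) (x≤ ∷ a≤) with ⊖-onto B x x≤ | shift-onto B a a≤
... | m , m< , refl | p , p< , refl = m ∷ p , m< ∷ p< , refl

shift-+ : ∀ {d} a b (p q : Vec ℕ d) → shift a p +ᵥ shift b q ≡ shift (a + b) (p +ⁿ q)
shift-+ a b []      []      = refl
shift-+ a b (m ∷ p) (n ∷ q) = cong₂ _∷_ (⊖-+-⊖ m a n b) (shift-+ a b p q)

shift-foldr : ∀ {k d} B (x : Fin k → Vec ℕ d) u →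
              shift (k * B) (foldr _+ⁿ_ u x) ≡ foldr _+ᵥ_ (shift 0 u) (shift B ∘ x)
shift-foldr {zero}  B x u = refl
shift-foldr {suc k} B x u =
  trans (sym (shift-+ B (k * B) (x zero) _)) (cong (shift B (x zero) +ᵥ_) (shift-foldr B (x ∘ suc) u))

shift-zero : ∀ {d} (p : Vec ℕ d) → shift 0 p ≡ Vec.map ℤ.+_ p
shift-zero []      = refl
shift-zero (m ∷ p) = cong₂ _∷_ (ℤ.⊖-≥ z≤n) (shift-zero p)

⊕-∈ : ∀ {d} {A B : FinSet d} {a b} → a ∈ A → b ∈ B → a +ᵥ b ∈ A ⊕ B
⊕-∈ {a = a} a∈A b∈B = ∈-concatMap⁺ _ (lose a∈A (∈-map⁺ (a +ᵥ_) b∈B))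

sumFamily-∈ : ∀ {d} k (A : Fin k → FinSet d) U (x : Fin k → Point d) {u} →
              (∀ i → x i ∈ A i) → u ∈ U → foldr _+ᵥ_ u x ∈ sumFamily k A U
sumFamily-∈ zero    A U x x∈A u∈U = u∈U
sumFamily-∈ (suc k) A U x x∈A u∈U = ⊕-∈ (x∈A zero) (sumFamily-∈ k (A ∘ suc) U (x ∘ suc) (x∈A ∘ suc) u∈U)

cube-∈ : ∀ d k {u : Vec ℕ d} → All (_< k) u → Vec.map ℤ.+_ u ∈ cube d k
cube-∈ zero    k []          = here refl
cube-∈ (suc d) k (u<k ∷ us<k) = ∈-concatMap⁺ _ (lose (∈-upTo⁺ u<k) (∈-map⁺ _ (cube-∈ d k us<k)))

length-concatMap : ∀ {A B : Set} (f : A → List B) n xs → (∀ x → length (f x) ≡ n) → length (concatMap f xs) ≡ length xs * n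
length-concatMap f n []       _   = refl
length-concatMap f n (x ∷ xs) len = trans (length-++ (f x)) (cong₂ _+_ (len x) (length-concatMap f n xs len))

length-cube : ∀ d k → length (cube d k) ≡ k ^ d
length-cube zero    k = refl
length-cube (suc d) k = trans (length-concatMap _ (k ^ d) (upTo k) (λ i → trans (length-map _ (cube d k)) (length-cube d k)))
                              (cong (_* k ^ d) (length-upTo k))

grid : ∀ d → ℕ → List (Vec ℕ d)
grid zero    D = [] ∷ []
grid (suc d) D = cartesianProductWith _∷_ (upTo D) (grid d D)

grid-unique : ∀ d D → Unique (grid d D)
grid-unique zero    D = ListAll.[] ∷ []
grid-unique (suc d) D = Unique.cartesianProductWith⁺ _∷_ ∷-injective (Unique.upTo⁺ D) (grid-unique d D)

∈-grid : ∀ {d D} {p : Vec ℕ d} → All (_< D) p → p ∈ grid d D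
∈-grid []          = here refl
∈-grid (n<D ∷ p<D) = ∈-cartesianProductWith⁺ _∷_ (∈-upTo⁺ n<D) (∈-grid p<D)

sum-map-cartesianProductWith : ∀ {A B C : Set} (g : C → ℕ) (f : A → B → C) xs ys →
  sum (map g (cartesianProductWith f xs ys)) ≡ sum (map (λ x → sum (map (g ∘ f x) ys)) xs)
sum-map-cartesianProductWith g f []       ys = refl
sum-map-cartesianProductWith g f (x ∷ xs) ys = begin
  sum (map g (map (f x) ys ++ cartesianProductWith f xs ys))        ≡⟨ cong sum (map-++ g (map (f x) ys) _) ⟩
  sum (map g (map (f x) ys) ++ map g (cartesianProductWith f xs ys)) ≡⟨ sum-++ (map g (map (f x) ys)) _ ⟩
  sum (map g (map (f x) ys)) + sum (map g (cartesianProductWith f xs ys))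
    ≡⟨ cong₂ _+_ (cong sum (sym (map-∘ ys))) (sum-map-cartesianProductWith g f xs ys) ⟩
  sum (map (g ∘ f x) ys) + sum (map (λ x → sum (map (g ∘ f x) ys)) xs) ∎
  where open ≡-Reasoning

sum-map-applyUpTo : ∀ (h f : ℕ → ℕ) n → sum (map h (applyUpTo f n)) ≡ ∑[ i < n ] h (f i)
sum-map-applyUpTo h f zero    = refl
sum-map-applyUpTo h f (suc n) = cong (h (f 0) +_) (sum-map-applyUpTo h (f ∘ suc) n)

∑□-grid : ∀ d D g → ∑□ d D g ≡ sum (map g (grid d D))
∑□-grid zero    D g = sym (+-identityʳ (g []))
∑□-grid (suc d) D g = begin
  ∑[ n < D ] ∑□ d D (λ q → g (n ∷ q))                 ≡⟨ ∑<-cong D (λ n _ → ∑□-grid d D (λ q → g (n ∷ q))) ⟩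
  ∑[ n < D ] sum (map (λ q → g (n ∷ q)) (grid d D))   ≡⟨ sum-map-applyUpTo _ (λ n → n) D ⟨
  sum (map (λ n → sum (map (g ∘ (n ∷_)) (grid d D))) (upTo D)) ≡⟨ sum-map-cartesianProductWith g _∷_ (upTo D) (grid d D) ⟨
  sum (map g (grid (suc d) D))                        ∎
  where open ≡-Reasoning

_≟ᵖ_ : ∀ {d} (p q : Point d) → Dec (p ≡ q)
_≟ᵖ_ = ≡-dec ℤ._≟_

_∈ᵖ?_ : ∀ {d} (p : Point d) (X : FinSet d) → Dec (p ∈ X)
p ∈ᵖ? X = any? (p ≟ᵖ_) X

Unique⇒length≤ : ∀ {A : Set} {xs ys : List A} → Unique xs → (∀ {v} → v ∈ xs → v ∈ ys) → length xs ≤ length ys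
Unique⇒length≤ {xs = []}     _            _    = z≤n
Unique⇒length≤ {xs = x ∷ xs} (x∉xs ∷ uxs) x∷xs⊆ys with ∈-∃++ (x∷xs⊆ys (here refl))
... | ys₁ , ys₂ , refl = begin
  suc (length xs)                 ≤⟨ s≤s (Unique⇒length≤ uxs xs⊆ys₁ys₂) ⟩
  suc (length (ys₁ ++ ys₂))       ≡⟨ cong suc (length-++ ys₁) ⟩
  suc (length ys₁ + length ys₂)   ≡⟨ +-suc (length ys₁) (length ys₂) ⟨
  length ys₁ + length (x ∷ ys₂)   ≡⟨ length-++ ys₁ ⟨
  length (ys₁ ++ x ∷ ys₂)         ∎
  where
  open ≤-Reasoning
  xs⊆ys₁ys₂ : ∀ {v} → v ∈ xs → v ∈ ys₁ ++ ys₂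
  xs⊆ys₁ys₂ v∈xs with ∈-++⁻ ys₁ (x∷xs⊆ys (there v∈xs))
  ... | inj₁ v∈ys₁          = ∈-++⁺ˡ v∈ys₁
  ... | inj₂ (here refl)    = contradiction refl (ListAll.lookup x∉xs v∈xs)
  ... | inj₂ (there v∈ys₂) = ∈-++⁺ʳ ys₁ v∈ys₂

sum-χ≡length-filter : ∀ {A : Set} {P : A → Set} (P? : Decidable P) xs → sum (map (χ ∘ P?) xs) ≡ length (filter P? xs)
sum-χ≡length-filter P? []       = refl
sum-χ≡length-filter P? (x ∷ xs) with P? x
... | yes _ = cong suc (sum-χ≡length-filter P? xs)
... | no _  = sum-χ≡length-filter P? xs

card≤length : ∀ {d} (X : FinSet d) → card X ≤ length X
card≤length X = Unique⇒length≤ (deduplicate-! _≟ᵖ_ X) (∈-deduplicate⁻ _≟ᵖ_ X)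

∑□-χ-≡-length : ∀ {d} D B (X : FinSet d) →
                ∑□ d D (λ p → χ (shift B p ∈ᵖ? X)) ≡ length (map (shift B) (filter (λ p → shift B p ∈ᵖ? X) (grid d D)))
∑□-χ-≡-length {d} D B X = begin
  ∑□ d D (χ ∘ P?)                              ≡⟨ ∑□-grid d D (χ ∘ P?) ⟩
  sum (map (χ ∘ P?) (grid d D))                ≡⟨ sum-χ≡length-filter P? (grid d D) ⟩
  length (filter P? (grid d D))                ≡⟨ length-map (shift B) (filter P? (grid d D)) ⟨
  length (map (shift B) (filter P? (grid d D))) ∎
  where
  open ≡-Reasoning
  P? = λ p → shift B p ∈ᵖ? X

∑□-χ≤card : ∀ {d} D B (T : FinSet d) → ∑□ d D (λ p → χ (shift B p ∈ᵖ? T)) ≤ card T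
∑□-χ≤card {d} D B T = subst (_≤ card T) (sym (∑□-χ-≡-length D B T))
  (Unique⇒length≤ (Unique.map⁺ (shift-injective B) (Unique.filter⁺ P? {grid d D} (grid-unique d D))) ⊆T)
  where
  P? = λ p → shift B p ∈ᵖ? T
  ⊆T : ∀ {v} → v ∈ map (shift B) (filter P? (grid d D)) → v ∈ deduplicate _≟ᵖ_ T
  ⊆T v∈ with ∈-map⁻ (shift B) v∈
  ... | p , p∈ , refl = ∈-deduplicate⁺ _≟ᵖ_ (proj₂ (∈-filter⁻ P? {xs = grid d D} p∈))

card≤∑□-χ : ∀ {d} B (A : FinSet d) → (∀ {a} → a ∈ A → Bounded B a) →
            card A ≤ ∑□ d (suc (B + B)) (λ p → χ (shift B p ∈ᵖ? A))
card≤∑□-χ {d} B A bounded = subst (card A ≤_) (sym (∑□-χ-≡-length (suc (B + B)) B A))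
  (Unique⇒length≤ (deduplicate-! _≟ᵖ_ A) ⊆grid)
  where
  P? = λ p → shift B p ∈ᵖ? A
  ⊆grid : ∀ {a} → a ∈ deduplicate _≟ᵖ_ A → a ∈ map (shift B) (filter P? (grid d (suc (B + B))))
  ⊆grid {a} a∈ with ∈-deduplicate⁻ _≟ᵖ_ A a∈
  ... | a∈A with shift-onto B a (bounded a∈A)
  ...   | p , p<D , refl = ∈-map⁺ (shift B) (∈-filter⁺ P? (∈-grid p<D) a∈A)

∥_∥₁ : ∀ {d} → Point d → ℕ
∥ []    ∥₁ = 0
∥ x ∷ p ∥₁ = ∣ x ∣ + ∥ p ∥₁

radius : ∀ {d} → FinSet d → ℕ
radius []      = 0
radius (p ∷ X) = ∥ p ∥₁ + radius X

Bounded-mono : ∀ {d B B′} {p : Point d} → B ≤ B′ → Bounded B p → Bounded B′ p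
Bounded-mono B≤B′ = AllV.map (λ x≤B → ≤-trans x≤B B≤B′)

Bounded-∥∥₁ : ∀ {d} (p : Point d) → Bounded ∥ p ∥₁ p
Bounded-∥∥₁ []      = []
Bounded-∥∥₁ (x ∷ p) = m≤m+n ∣ x ∣ ∥ p ∥₁ ∷ Bounded-mono (m≤n+m ∥ p ∥₁ ∣ x ∣) (Bounded-∥∥₁ p)

∥∥₁≤radius : ∀ {d} {X : FinSet d} {p} → p ∈ X → ∥ p ∥₁ ≤ radius X
∥∥₁≤radius (here refl) = m≤m+n _ _
∥∥₁≤radius (there p∈X) = ≤-trans (∥∥₁≤radius p∈X) (m≤n+m _ _)

prodCard≡∏ᶠcard : ∀ {d} k (A : Fin k → FinSet d) → prodCard k A ≡ ∏ᶠ[ i ] card (A i)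
prodCard≡∏ᶠcard zero    A = refl
prodCard≡∏ᶠcard (suc k) A = cong (card (A zero) *_) (prodCard≡∏ᶠcard k (A ∘ suc))

cube-sumset : ∀ d k (A : Fin k → FinSet d) → card (cube d k) ^ k * prodCard k A ≤ card (sumFamily k A (cube d k)) ^ k
cube-sumset d zero    A = ≤-refl
cube-sumset d (suc k) A = begin
  card (cube d K) ^ K * prodCard K A
    ≤⟨ *-mono-≤ (^-monoˡ-≤ K (≤-trans (card≤length (cube d K)) (≤-reflexive (length-cube d K))))
                (≤-trans (≤-reflexive (prodCard≡∏ᶠcard K A)) (∏ᶠ-mono-≤ (λ i → card≤∑□-χ B (A i) (bounded i)))) ⟩
  (K ^ d) ^ K * ∏ᶠ[ i ] ∑□ d D (α i)
    ≡⟨ cong (_* ∏ᶠ[ i ] ∑□ d D (α i)) exponents ⟩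
  1 * (K ^ K) ^ d * ∏ᶠ[ i ] ∑□ d D (α i)
    ≤⟨ prékopa–leindler d k D 1 α η α-supp α≤η ⟩
  ∑□ d (K * D) η ^ K
    ≤⟨ ^-monoˡ-≤ K (∑□-χ≤card (K * D) (K * B) T) ⟩
  card T ^ K
    ∎
  where
  open ≤-Reasoning
  K = suc k
  T = sumFamily K A (cube d K)
  B = ∑ᶠ[ i ] radius (A i)
  D = suc (B + B)

  α : Fin K → Vec ℕ d → ℕ
  α i p = χ (shift B p ∈ᵖ? A i)

  η : Vec ℕ d → ℕ
  η z = χ (shift (K * B) z ∈ᵖ? T)

  exponents : (K ^ d) ^ K ≡ 1 * (K ^ K) ^ d
  exponents = trans (^-*-assoc K d K) (trans (cong (K ^_) (*-comm d K)) (trans (sym (^-*-assoc K K d)) (sym (*-identityˡ _))))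

  bounded : ∀ i {a} → a ∈ A i → Bounded B a
  bounded i a∈A = Bounded-mono (≤-trans (∥∥₁≤radius a∈A) (f≤∑ᶠf (radius ∘ A) i)) (Bounded-∥∥₁ _)

  α-supp : ∀ i {p} → ¬ All (_< D) p → α i p ≡ 0
  α-supp i {p} p≮D = χ-¬ (shift B p ∈ᵖ? A i) (λ p∈A → p≮D (shift-bounded B p (bounded i p∈A)))

  α≤η : ∀ (x : Fin K → Vec ℕ d) u → All (_< K) u → 1 * ∏ᶠ[ i ] α i (x i) ≤ η (foldr _+ⁿ_ u x) ^ K
  α≤η x u u<K with all? (λ i → shift B (x i) ∈ᵖ? A i)
  ... | yes x∈A = begin
    1 * ∏ᶠ[ i ] α i (x i)        ≤⟨ *-monoʳ-≤ 1 (∏ᶠ-mono-≤ (λ i → χ≤1 (shift B (x i) ∈ᵖ? A i))) ⟩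
    1 * ∏ᶠ {K} (λ _ → 1)        ≡⟨ trans (*-identityˡ _) (∏ᶠ-const K 1) ⟩
    1 ^ K                        ≡⟨ cong (_^ K) (χ-yes (_ ∈ᵖ? T) sum∈T) ⟨
    η (foldr _+ⁿ_ u x) ^ K       ∎
    where
    sum∈T : shift (K * B) (foldr _+ⁿ_ u x) ∈ T
    sum∈T = subst (_∈ T) (sym (shift-foldr B x u))
                  (sumFamily-∈ K A (cube d K) (shift B ∘ x) x∈A (subst (_∈ cube d K) (sym (shift-zero u)) (cube-∈ d K u<K)))
  ... | no x∉A with ¬∀⟶∃¬ K _ (λ i → shift B (x i) ∈ᵖ? A i) x∉A
  ...   | i , xi∉Ai = subst (_≤ η (foldr _+ⁿ_ u x) ^ K)
                            (sym (trans (*-identityˡ _) (∏ᶠ-zero (λ i → α i (x i)) i (χ-¬ (shift B (x i) ∈ᵖ? A i) xi∉Ai)))) z≤n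

lemma2p13 : (d k : ℕ) → 1 ≤ d → 1 ≤ k → (A : Fin k → FinSet d) →
    (card (cube d k) ^ k) * prodCard k A ≤ card (sumFamily k A (cube d k)) ^ k
lemma2p13 d k _ _ = cube-sumset d k
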